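{- Let $S(q)$ be the formal power series defined in the context and $S^{(2)}(q)=\frac{S(q)-1-q}{q^2}$. Then $$1-S^{(2)}(q)=\cfrac{1}{1+\cfrac{q^2}{1+q^2-\cfrac{q^3}{1+\cfrac{q^2}{1+q^2-\cfrac{q^3}{\ddots}}}}}$$ where the partial denominators alternate $1,\,1+q^2$ (starting with $1$) and the partial numerators after the first alternate $+q^2,-q^3$.
   Context: $S(q)\in\mathbb{Z}[[q]]$ is the Taylor expansion at $q=0$ of $\frac{q^3+2q-1+\sqrt{(1-q+q^2)(1+q+4q^2+q^3+q^4)}}{2q}$ (square-root branch equal to $1$ at $q=0$); equivalently, the unique formal power series satisfying $q\,S(q)^2+(1-2q-q^3)S(q)=1$. It begins $1+q+q^4-\cdots$, so $S^{(2)}$ is a formal power series. Infinite continued fractions denote $q$-adic limits of their truncations. -}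

module Defs where

open import Data.Nat using (ℕ; zero; suc; _∸_; _≡ᵇ_; _≤_; _<_)
open import Data.Integer using (ℤ; _+_; _*_; -_; 0ℤ; 1ℤ)
open import Data.Bool using (if_then_else_)
open import Data.Product using (∃-syntax)
open import Relation.Binary.PropositionalEquality using (_≡_)

Series : Set
Series = ℕ → ℤ

sumTo : ℕ → (ℕ → ℤ) → ℤ
sumTo zero    f = f 0
sumTo (suc n) f = sumTo n f + f (suc n)

const : ℤ → Series
const c zero    = c
const c (suc _) = 0ℤ

q : Series
q 1 = 1ℤ
q _ = 0ℤ

infixl 6 _⊕_ _⊖_
infixl 7 _⊛_

_⊕_ : Series → Series → Series
(f ⊕ g) n = f n + g n

neg : Series → Series
neg f n = - f n

_⊖_ : Series → Series → Series
f ⊖ g = f ⊕ neg g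

_⊛_ : Series → Series → Series
(f ⊛ g) n = sumTo n (λ k → f k * g (n ∸ k))

-- Multiplicative inverse of a series whose constant term is a unit (±1) of ℤ:
-- g 0 = f 0 (= (f 0)⁻¹), g n = - f 0 * Σ_{k=1}^{n} f k * g (n - k).
-- invUpTo f n agrees with the inverse at indices ≤ n.
invUpTo : Series → ℕ → Series
invUpTo f zero    i = if i ≡ᵇ 0 then f 0 else 0ℤ
invUpTo f (suc n) i =
  if i ≡ᵇ suc n
  then - (f 0 * sumTo n (λ j → f (suc j) * invUpTo f n (suc n ∸ suc j)))
  else invUpTo f n i

inv : Series → Series
inv f n = invUpTo f n n

SEquation : Series → Set
SEquation S =
  ∀ n → ((q ⊛ S ⊛ S) ⊕ ((const 1ℤ ⊖ (q ⊕ q) ⊖ (q ⊛ q ⊛ q)) ⊛ S)) n ≡ const 1ℤ n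

-- S^{(2)} = (S - 1 - q) / q²
S2 : Series → Series
S2 S n = S (suc (suc n))

-- Continued fraction data: partial denominators b_1 = 1, b_2 = 1+q², b_3 = 1, ...
-- (b_k = 1 for k odd, 1+q² for k even), partial numerators a_1 = 1 and, for k ≥ 2,
-- a_k = q² for k even, a_k = -q³ for k odd.

even? : ℕ → Data.Bool.Bool
even? zero          = Data.Bool.true
even? (suc zero)    = Data.Bool.false
even? (suc (suc n)) = even? n

pden : ℕ → Series
pden k = if even? k then const 1ℤ ⊕ (q ⊛ q) else const 1ℤ

pnum : ℕ → Series     -- used for k ≥ 2
pnum k = if even? k then q ⊛ q else neg (q ⊛ q ⊛ q)

-- tailCF k m = b_k + a_{k+1} / (b_{k+1} + a_{k+2} / ( ... + a_{k+m} / b_{k+m}))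
tailCF : ℕ → ℕ → Series
tailCF k zero    = pden k
tailCF k (suc m) = pden k ⊕ (pnum (suc k) ⊛ inv (tailCF (suc k) m))

-- n-th truncation of  1 / (b_1 + a_2/(b_2 + a_3/(b_3 + ...))),
-- keeping partial denominators b_1, …, b_{n+1}.
convergent : ℕ → Series
convergent n = inv (tailCF 1 n)

QAdicLimit : (ℕ → Series) → Series → Set
QAdicLimit c L = ∀ N → ∃[ M ] (∀ n → M ≤ n → ∀ i → i < N → c n i ≡ L i)

{-# OPTIONS --safe #-}
-- Writing S = 1 + q + q²s (the equation forces S₀ = S₁ = 1), the equation for S becomes, for
-- T = 1 − s and B = 1 + q² − q³T, the identity T(B + q²) = B, i.e. T = 1/(1 + q²/B): T is a fixed
-- point of one period of the continued fraction.  As a₂ = q² and a₃ = −q³ are divisible by q and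
-- inversion respects congruences modulo q^N, every further level of the continued fraction fixes
-- one more coefficient, so the m-th convergent agrees with T modulo q^m.
module Submission where

open import Defs
open import Data.Integer using (1ℤ)

open import Level using (0ℓ)
open import Function.Base using (_∘_)
open import Data.Nat.Base as ℕ using (ℕ; zero; suc; _∸_; _≤_; _<_; z≤n; s≤s; _≡ᵇ_; _≤′_; ≤′-refl; ≤′-step)
import Data.Nat.Properties as ℕ
open import Data.Integer.Base using (ℤ; _+_; _-_; _*_; -_; 0ℤ)
import Data.Integer.Properties as ℤ
open import Data.Integer.Tactic.RingSolver using (solve-∀)
open import Data.Bool.Base using (true; false; if_then_else_)
open import Data.Maybe.Base using (Maybe; just; nothing)
open import Data.Product.Base using (_×_; _,_; proj₁; proj₂)
open import Relation.Nullary.Decidable.Core using (yes; no)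
open import Relation.Binary.PropositionalEquality
open import Algebra.Bundles using (CommutativeRing)
open import Algebra.Solver.Ring.AlmostCommutativeRing using (fromCommutativeRing; _-Raw-AlmostCommutative⟶_)
import Algebra.Solver.Ring
import Algebra.Properties.AbelianGroup
import Relation.Binary.Reasoning.Setoid

sumTo-cong : ∀ n {f g : ℕ → ℤ} → (∀ {k} → k ≤ n → f k ≡ g k) → sumTo n f ≡ sumTo n g
sumTo-cong zero    f≡g = f≡g z≤n
sumTo-cong (suc n) f≡g = cong₂ _+_ (sumTo-cong n (f≡g ∘ ℕ.m≤n⇒m≤1+n)) (f≡g ℕ.≤-refl)

sumTo-distrib-+ : ∀ n (f g : ℕ → ℤ) → sumTo n (λ k → f k + g k) ≡ sumTo n f + sumTo n g
sumTo-distrib-+ zero    f g = refl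
sumTo-distrib-+ (suc n) f g =
  trans (cong (_+ (f (suc n) + g (suc n))) (sumTo-distrib-+ n f g)) (interchange (sumTo n f) (sumTo n g) (f (suc n)) (g (suc n)))
  where
  interchange : ∀ a b c d → (a + b) + (c + d) ≡ (a + c) + (b + d)
  interchange = solve-∀

*-distribˡ-sumTo : ∀ n c (f : ℕ → ℤ) → c * sumTo n f ≡ sumTo n (λ k → c * f k)
*-distribˡ-sumTo zero    c f = refl
*-distribˡ-sumTo (suc n) c f =
  trans (ℤ.*-distribˡ-+ c (sumTo n f) (f (suc n))) (cong (_+ c * f (suc n)) (*-distribˡ-sumTo n c f))

*-distribʳ-sumTo : ∀ n c (f : ℕ → ℤ) → sumTo n f * c ≡ sumTo n (λ k → f k * c)
*-distribʳ-sumTo zero    c f = refl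
*-distribʳ-sumTo (suc n) c f =
  trans (ℤ.*-distribʳ-+ c (sumTo n f) (f (suc n))) (cong (_+ f (suc n) * c) (*-distribʳ-sumTo n c f))

sumTo-zero : ∀ n {f : ℕ → ℤ} → (∀ k → f k ≡ 0ℤ) → sumTo n f ≡ 0ℤ
sumTo-zero zero    f≡0 = f≡0 0
sumTo-zero (suc n) f≡0 = cong₂ _+_ (sumTo-zero n f≡0) (f≡0 (suc n))

sumTo-head : ∀ n (f : ℕ → ℤ) → sumTo (suc n) f ≡ f 0 + sumTo n (f ∘ suc)
sumTo-head zero    f = refl
sumTo-head (suc n) f = trans (cong (_+ f (suc (suc n))) (sumTo-head n f)) (ℤ.+-assoc (f 0) _ _)

sumTo-reverse : ∀ n (f : ℕ → ℤ) → sumTo n f ≡ sumTo n (λ k → f (n ∸ k))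
sumTo-reverse zero    f = refl
sumTo-reverse (suc n) f = begin
  sumTo (suc n) f                                ≡⟨ sumTo-head n f ⟩
  f 0 + sumTo n (f ∘ suc)                        ≡⟨ cong (f 0 +_) (sumTo-reverse n (f ∘ suc)) ⟩
  f 0 + sumTo n (λ k → f (suc (n ∸ k)))          ≡⟨ ℤ.+-comm (f 0) _ ⟩
  sumTo n (λ k → f (suc (n ∸ k))) + f 0          ≡⟨ cong₂ _+_ (sumTo-cong n (cong f ∘ sym ∘ ℕ.+-∸-assoc 1))
                                                              (cong f (sym (ℕ.n∸n≡0 n))) ⟩
  sumTo (suc n) (λ k → f (suc n ∸ k))            ∎
  where open ≡-Reasoning

sumTo-triangle : ∀ n (G : ℕ → ℕ → ℤ) →
  sumTo n (λ k → sumTo k (λ j → G j (k ∸ j))) ≡ sumTo n (λ j → sumTo (n ∸ j) (G j))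
sumTo-triangle zero    G = refl
sumTo-triangle (suc n) G = begin
  sumTo n (λ k → sumTo k (λ j → G j (k ∸ j))) + sumTo (suc n) (λ j → G j (suc n ∸ j))
    ≡⟨ cong (_+ sumTo (suc n) (λ j → G j (suc n ∸ j))) (sumTo-triangle n G) ⟩
  sumTo n (λ j → sumTo (n ∸ j) (G j)) + (sumTo n (λ j → G j (suc n ∸ j)) + G (suc n) (n ∸ n))
    ≡⟨ sym (ℤ.+-assoc (sumTo n (λ j → sumTo (n ∸ j) (G j))) _ _) ⟩
  (sumTo n (λ j → sumTo (n ∸ j) (G j)) + sumTo n (λ j → G j (suc n ∸ j))) + G (suc n) (n ∸ n)
    ≡⟨ cong (_+ G (suc n) (n ∸ n)) (sym (sumTo-distrib-+ n _ _)) ⟩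
  sumTo n (λ j → sumTo (n ∸ j) (G j) + G j (suc n ∸ j)) + G (suc n) (n ∸ n)
    ≡⟨ cong₂ _+_ (sumTo-cong n extend) lastTerm ⟩
  sumTo n (λ j → sumTo (suc n ∸ j) (G j)) + sumTo (n ∸ n) (G (suc n))
    ∎
  where
  open ≡-Reasoning
  lastTerm : G (suc n) (n ∸ n) ≡ sumTo (n ∸ n) (G (suc n))
  lastTerm rewrite ℕ.n∸n≡0 n = refl
  extend : ∀ {j} → j ≤ n → sumTo (n ∸ j) (G j) + G j (suc n ∸ j) ≡ sumTo (suc n ∸ j) (G j)
  extend j≤n rewrite ℕ.+-∸-assoc 1 j≤n = refl

1s : Series
1s = const 1ℤ

⊛-cong : ∀ {f f′ g g′} → f ≗ f′ → g ≗ g′ → f ⊛ g ≗ f′ ⊛ g′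
⊛-cong f≗f′ g≗g′ n = sumTo-cong n (λ {k} _ → cong₂ _*_ (f≗f′ k) (g≗g′ (n ∸ k)))

⊛-comm : ∀ f g → f ⊛ g ≗ g ⊛ f
⊛-comm f g n = trans (sumTo-reverse n _) (sumTo-cong n λ {k} k≤n →
  trans (cong (λ m → f (n ∸ k) * g m) (ℕ.m∸[m∸n]≡n k≤n)) (ℤ.*-comm (f (n ∸ k)) (g k)))

⊛-identityˡ : ∀ f → 1s ⊛ f ≗ f
⊛-identityˡ f zero    = ℤ.*-identityˡ (f 0)
⊛-identityˡ f (suc n) = begin
  (1s ⊛ f) (suc n)                                  ≡⟨ sumTo-head n _ ⟩
  1ℤ * f (suc n) + sumTo n (λ k → 0ℤ * f (n ∸ k))   ≡⟨ cong₂ _+_ (ℤ.*-identityˡ (f (suc n))) (sumTo-zero n λ _ → refl) ⟩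
  f (suc n) + 0ℤ                                    ≡⟨ ℤ.+-identityʳ (f (suc n)) ⟩
  f (suc n)                                         ∎
  where open ≡-Reasoning

⊛-distribˡ-⊕ : ∀ f g h → f ⊛ (g ⊕ h) ≗ f ⊛ g ⊕ f ⊛ h
⊛-distribˡ-⊕ f g h n =
  trans (sumTo-cong n λ {k} _ → ℤ.*-distribˡ-+ (f k) (g (n ∸ k)) (h (n ∸ k))) (sumTo-distrib-+ n _ _)

⊛-assoc : ∀ f g h → (f ⊛ g) ⊛ h ≗ f ⊛ (g ⊛ h)
⊛-assoc f g h n = begin
  sumTo n (λ k → sumTo k (λ j → f j * g (k ∸ j)) * h (n ∸ k))
    ≡⟨ sumTo-cong n (λ {k} k≤n → trans (*-distribʳ-sumTo k _ _) (sumTo-cong k (reassociate k≤n))) ⟩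
  sumTo n (λ k → sumTo k (λ j → G j (k ∸ j)))
    ≡⟨ sumTo-triangle n G ⟩
  sumTo n (λ j → sumTo (n ∸ j) (G j))
    ≡⟨ sumTo-cong n (λ {j} _ → sym (*-distribˡ-sumTo (n ∸ j) (f j) _)) ⟩
  sumTo n (λ j → f j * sumTo (n ∸ j) (λ l → g l * h (n ∸ j ∸ l)))
    ∎
  where
  open ≡-Reasoning
  G : ℕ → ℕ → ℤ
  G j l = f j * (g l * h (n ∸ j ∸ l))
  reassociate : ∀ {k j} → k ≤ n → j ≤ k → f j * g (k ∸ j) * h (n ∸ k) ≡ G j (k ∸ j)
  reassociate {k} {j} k≤n j≤k = trans (ℤ.*-assoc (f j) _ _) (cong (λ m → f j * (g (k ∸ j) * h m))
    (sym (trans (ℕ.∸-+-assoc n j (k ∸ j)) (cong (n ∸_) (ℕ.m+[n∸m]≡n j≤k)))))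

seriesRing : CommutativeRing 0ℓ 0ℓ
seriesRing = record
  { Carrier = Series ; _≈_ = _≗_ ; _+_ = _⊕_ ; _*_ = _⊛_ ; -_ = neg ; 0# = λ _ → 0ℤ ; 1# = 1s
  ; isCommutativeRing = record
    { isRing = record
      { +-isAbelianGroup = record
        { isGroup = record
          { isMonoid = record
            { isSemigroup = record
              { isMagma = record
                { isEquivalence = record { refl = λ _ → refl ; sym = λ p n → sym (p n) ; trans = λ p r n → trans (p n) (r n) }
                ; ∙-cong = λ p r n → cong₂ _+_ (p n) (r n) }
              ; assoc = λ f g h n → ℤ.+-assoc (f n) (g n) (h n) }
            ; identity = (λ f n → ℤ.+-identityˡ (f n)) , (λ f n → ℤ.+-identityʳ (f n)) }
          ; inverse = (λ f n → ℤ.+-inverseˡ (f n)) , (λ f n → ℤ.+-inverseʳ (f n))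
          ; ⁻¹-cong = λ p n → cong -_ (p n) }
        ; comm = λ f g n → ℤ.+-comm (f n) (g n) }
      ; *-cong = ⊛-cong
      ; *-assoc = ⊛-assoc
      ; *-identity = ⊛-identityˡ , (λ f n → trans (⊛-comm f 1s n) (⊛-identityˡ f n))
      ; distrib = ⊛-distribˡ-⊕ , λ f g h n → trans (⊛-comm (g ⊕ h) f n)
                    (trans (⊛-distribˡ-⊕ f g h n) (cong₂ _+_ (⊛-comm f g n) (⊛-comm f h n))) }
    ; *-comm = ⊛-comm } }

module R = CommutativeRing seriesRing

constHomomorphism :
  CommutativeRing.rawRing ℤ.+-*-commutativeRing -Raw-AlmostCommutative⟶ fromCommutativeRing seriesRing
constHomomorphism = record
  { ⟦_⟧    = const
  ; +-homo = λ a b → λ { zero → refl ; (suc n) → refl }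
  ; *-homo = λ a b → λ { zero → refl ; (suc n) → sym (trans (sumTo-head n _)
                                          (cong₂ _+_ (ℤ.*-zeroʳ a) (sumTo-zero n λ _ → refl))) }
  ; -‿homo = λ a → λ { zero → refl ; (suc n) → refl }
  ; 0-homo = λ { zero → refl ; (suc n) → refl }
  ; 1-homo = λ _ → refl
  }

const-≗? : ∀ a b → Maybe (const a ≗ const b)
const-≗? a b with a ℤ.≟ b
... | yes refl = just λ _ → refl
... | no _     = nothing

module SeriesSolver = Algebra.Solver.Ring (CommutativeRing.rawRing ℤ.+-*-commutativeRing)
  (fromCommutativeRing seriesRing) constHomomorphism const-≗?
open SeriesSolver using (solve; _:=_; _:+_; _:-_; _:*_; :-_; con)

q⊛-suc : ∀ f n → (q ⊛ f) (suc n) ≡ f n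
q⊛-suc f zero    = trans (ℤ.+-identityˡ (1ℤ * f 0)) (ℤ.*-identityˡ (f 0))
q⊛-suc f (suc n) = begin
  (q ⊛ f) (suc (suc n))                                   ≡⟨ sumTo-head (suc n) _ ⟩
  0ℤ + sumTo (suc n) (λ k → q (suc k) * f (suc n ∸ k))    ≡⟨ ℤ.+-identityˡ _ ⟩
  sumTo (suc n) (λ k → q (suc k) * f (suc n ∸ k))         ≡⟨ sumTo-head n _ ⟩
  1ℤ * f (suc n) + sumTo n (λ k → 0ℤ * f (n ∸ k))         ≡⟨ cong₂ _+_ (ℤ.*-identityˡ (f (suc n))) (sumTo-zero n λ _ → refl) ⟩
  f (suc n) + 0ℤ                                          ≡⟨ ℤ.+-identityʳ (f (suc n)) ⟩
  f (suc n)                                               ∎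
  where open ≡-Reasoning

q⊛-injective : ∀ {f g} → q ⊛ f ≗ q ⊛ g → f ≗ g
q⊛-injective {f} {g} qf≗qg n = trans (sym (q⊛-suc f n)) (trans (qf≗qg (suc n)) (q⊛-suc g n))

≡ᵇ-refl : ∀ n → (n ≡ᵇ n) ≡ true
≡ᵇ-refl zero    = refl
≡ᵇ-refl (suc n) = ≡ᵇ-refl n

<⇒≡ᵇ-false : ∀ {m n} → m < n → (m ≡ᵇ n) ≡ false
<⇒≡ᵇ-false {zero}  {suc n} _         = refl
<⇒≡ᵇ-false {suc m} {suc n} (s≤s m<n) = <⇒≡ᵇ-false m<n

invUpTo-stable : ∀ f {i n} → i ≤ n → invUpTo f n i ≡ inv f i
invUpTo-stable f = stable ∘ ℕ.≤⇒≤′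
  where
  stable : ∀ {i n} → i ≤′ n → invUpTo f n i ≡ inv f i
  stable ≤′-refl = refl
  stable (≤′-step i≤′n) rewrite <⇒≡ᵇ-false (s≤s (ℕ.≤′⇒≤ i≤′n)) = stable i≤′n

inv-suc : ∀ f n → inv f (suc n) ≡ - (f 0 * sumTo n (λ j → f (suc j) * inv f (n ∸ j)))
inv-suc f n rewrite ≡ᵇ-refl n =
  cong (λ x → - (f 0 * x)) (sumTo-cong n λ {j} _ → cong (f (suc j) *_) (invUpTo-stable f (ℕ.m∸n≤m n j)))

inv-inverseʳ : ∀ f → f 0 * f 0 ≡ 1ℤ → f ⊛ inv f ≗ 1s
inv-inverseʳ f f0²≡1 zero    = f0²≡1
inv-inverseʳ f f0²≡1 (suc n) = begin
  (f ⊛ inv f) (suc n)            ≡⟨ sumTo-head n _ ⟩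
  f 0 * inv f (suc n) + Σ        ≡⟨ cong (λ y → f 0 * y + Σ) (inv-suc f n) ⟩
  f 0 * - (f 0 * Σ) + Σ          ≡⟨ regroup (f 0) Σ ⟩
  (1ℤ - f 0 * f 0) * Σ           ≡⟨ cong (λ u → (1ℤ - u) * Σ) f0²≡1 ⟩
  0ℤ                             ∎
  where
  open ≡-Reasoning
  Σ = sumTo n (λ j → f (suc j) * inv f (n ∸ j))
  regroup : ∀ a x → a * - (a * x) + x ≡ (1ℤ - a * a) * x
  regroup = solve-∀

inv-unique : ∀ {f g} → f 0 * f 0 ≡ 1ℤ → f ⊛ g ≗ 1s → inv f ≗ g
inv-unique {f} {g} f0²≡1 fg≗1 = begin
  inv f                  ≈⟨ R.sym (R.*-identityʳ (inv f)) ⟩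
  inv f ⊛ 1s             ≈⟨ R.*-congˡ {inv f} (R.sym fg≗1) ⟩
  inv f ⊛ (f ⊛ g)        ≈⟨ R.sym (R.*-assoc (inv f) f g) ⟩
  (inv f ⊛ f) ⊛ g        ≈⟨ R.*-congʳ {g} (R.*-comm (inv f) f) ⟩
  (f ⊛ inv f) ⊛ g        ≈⟨ R.*-congʳ {g} (inv-inverseʳ f f0²≡1) ⟩
  1s ⊛ g                 ≈⟨ ⊛-identityˡ g ⟩
  g                      ∎
  where open Relation.Binary.Reasoning.Setoid R.setoid

infix 4 _≈[_]_
record _≈[_]_ (f : Series) (N : ℕ) (g : Series) : Set where
  constructor agreeBelow
  field agree : ∀ i → i < N → f i ≡ g i
open _≈[_]_

q^_∣_ : ℕ → Series → Set
q^ k ∣ f = ∀ i → i < k → f i ≡ 0ℤ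

≗⇒≈[] : ∀ {f g N} → f ≗ g → f ≈[ N ] g
≗⇒≈[] f≗g = agreeBelow λ i _ → f≗g i

≈[]-trans : ∀ {f g h N} → f ≈[ N ] g → g ≈[ N ] h → f ≈[ N ] h
≈[]-trans f≈g g≈h = agreeBelow λ i i<N → trans (agree f≈g i i<N) (agree g≈h i i<N)

⊕-congˡ-≈[] : ∀ f {g g′ N} → g ≈[ N ] g′ → f ⊕ g ≈[ N ] f ⊕ g′
⊕-congˡ-≈[] f g≈g′ = agreeBelow λ i i<N → cong (f i +_) (agree g≈g′ i i<N)

⊛-congˡ-≈[] : ∀ {k} f {g g′ N} → q^ k ∣ f → g ≈[ N ] g′ → f ⊛ g ≈[ k ℕ.+ N ] f ⊛ g′
⊛-congˡ-≈[] {k} f {g} {g′} {N} q^k∣f g≈g′ = agreeBelow λ i i<k+N → sumTo-cong i (termwise i<k+N)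
  where
  termwise : ∀ {i j} → i < k ℕ.+ N → j ≤ i → f j * g (i ∸ j) ≡ f j * g′ (i ∸ j)
  termwise {i} {j} i<k+N j≤i with j ℕ.<? k
  ... | yes j<k rewrite q^k∣f j j<k = refl
  ... | no  j≮k = cong (f j *_) (agree g≈g′ (i ∸ j) (ℕ.<-≤-trans (ℕ.∸-monoˡ-< i<k+N j≤i)
                    (ℕ.≤-trans (ℕ.∸-monoʳ-≤ (k ℕ.+ N) (ℕ.≮⇒≥ j≮k)) (ℕ.≤-reflexive (ℕ.m+n∸m≡n k N)))))

invUpTo-cong : ∀ {f g} n → (∀ {i} → i ≤ n → f i ≡ g i) → invUpTo f n ≗ invUpTo g n
invUpTo-cong zero    f≡g i = cong (λ x → if i ≡ᵇ 0 then x else 0ℤ) (f≡g z≤n)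
invUpTo-cong (suc n) f≡g i = cong₂ (λ x y → if i ≡ᵇ suc n then x else y)
  (cong -_ (cong₂ _*_ (f≡g z≤n) (sumTo-cong n λ {j} j≤n →
    cong₂ _*_ (f≡g (s≤s j≤n)) (invUpTo-cong n (f≡g ∘ ℕ.m≤n⇒m≤1+n) (n ∸ j)))))
  (invUpTo-cong n (f≡g ∘ ℕ.m≤n⇒m≤1+n) i)

inv-cong-≈[] : ∀ {f g N} → f ≈[ N ] g → inv f ≈[ N ] inv g
inv-cong-≈[] f≈g = agreeBelow λ i i<N → invUpTo-cong i (λ j≤i → agree f≈g _ (ℕ.≤-<-trans j≤i i<N)) i

q∣pnum : ∀ k → q^ 1 ∣ pnum k
q∣pnum k zero _ with even? k
... | true  = refl
... | false = refl
q∣pnum k (suc i) (s≤s ())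

tailCF-periodic : ∀ k m → tailCF (suc (suc k)) m ≡ tailCF k m
tailCF-periodic k zero    = refl
tailCF-periodic k (suc m) = cong (λ t → pden k ⊕ pnum (suc k) ⊛ inv t) (tailCF-periodic (suc k) m)

tail₂ : Series → Series
tail₂ T = pden 2 ⊕ pnum 3 ⊛ T

period : Series → Series
period T = inv (pden 1 ⊕ pnum 2 ⊛ inv (tail₂ T))

module _ {T : Series} (T≗periodT : T ≗ period T) where

  convergents-approximate : ∀ m → convergent m ≈[ m ] T × tailCF 2 m ≈[ m ] tail₂ T
  convergents-approximate zero    = agreeBelow (λ _ ()) , agreeBelow (λ _ ())
  convergents-approximate (suc m) = convergent-step , tail-step
    where
    convergent-step : inv (pden 1 ⊕ pnum 2 ⊛ inv (tailCF 2 m)) ≈[ suc m ] T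
    convergent-step = ≈[]-trans
      (inv-cong-≈[] (⊕-congˡ-≈[] (pden 1) (⊛-congˡ-≈[] (pnum 2) (q∣pnum 2)
        (inv-cong-≈[] (proj₂ (convergents-approximate m))))))
      (≗⇒≈[] (R.sym T≗periodT))
    tail-step : tail₂ (inv (tailCF 3 m)) ≈[ suc m ] tail₂ T
    tail-step rewrite tailCF-periodic 1 m =
      ⊕-congˡ-≈[] (pden 2) (⊛-congˡ-≈[] (pnum 3) (q∣pnum 3) (proj₁ (convergents-approximate m)))

  convergent-limit : QAdicLimit convergent T
  convergent-limit N =
    N , λ n N≤n i i<N → agree (proj₁ (convergents-approximate n)) i (ℕ.<-≤-trans i<N N≤n)

period-fixedPoint : ∀ {T} → T ⊛ (tail₂ T ⊕ q ⊛ q) ≗ tail₂ T → T ≗ period T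
period-fixedPoint {T} T[B⊕q²]≗B = R.sym (inv-unique refl (begin
  (1s ⊕ q ⊛ q ⊛ inv B) ⊛ T
    ≈⟨ R.*-congʳ {T} (R.+-congʳ {q ⊛ q ⊛ inv B} (R.sym (inv-inverseʳ B refl))) ⟩
  (B ⊛ inv B ⊕ q ⊛ q ⊛ inv B) ⊛ T  ≈⟨ regroup q B (inv B) T ⟩
  inv B ⊛ (T ⊛ (B ⊕ q ⊛ q))        ≈⟨ R.*-congˡ {inv B} T[B⊕q²]≗B ⟩
  inv B ⊛ B                        ≈⟨ R.*-comm (inv B) B ⟩
  B ⊛ inv B                        ≈⟨ inv-inverseʳ B refl ⟩
  1s                               ∎))
  where
  open Relation.Binary.Reasoning.Setoid R.setoid
  B = tail₂ T
  regroup : ∀ x b b⁻¹ t → (b ⊛ b⁻¹ ⊕ x ⊛ x ⊛ b⁻¹) ⊛ t ≗ b⁻¹ ⊛ (t ⊛ (b ⊕ x ⊛ x))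
  regroup = solve 4 (λ x b b⁻¹ t → (b :* b⁻¹ :+ x :* x :* b⁻¹) :* t := b⁻¹ :* (t :* (b :+ x :* x))) R.refl

quadratic : Series → Series
quadratic Y = q ⊛ Y ⊛ Y ⊕ (1s ⊖ (q ⊕ q) ⊖ q ⊛ q ⊛ q) ⊛ Y

quadratic-cong : ∀ {Y Y′} → Y ≗ Y′ → quadratic Y ≗ quadratic Y′
quadratic-cong Y≗Y′ =
  R.+-cong (R.*-cong (R.*-congˡ {q} Y≗Y′) Y≗Y′) (R.*-congˡ {1s ⊖ (q ⊕ q) ⊖ q ⊛ q ⊛ q} Y≗Y′)

module _ {S : Series} (S-eq : SEquation S) where

  private
    X : Series
    X = S ⊛ S ⊖ (S ⊕ S) ⊖ q ⊛ (q ⊛ S)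

    S⊕q⊛X≗1 : S ⊕ q ⊛ X ≗ 1s
    S⊕q⊛X≗1 = R.trans (R.sym (regroup q S)) S-eq
      where
      regroup : ∀ x Y →
        x ⊛ Y ⊛ Y ⊕ (1s ⊖ (x ⊕ x) ⊖ x ⊛ x ⊛ x) ⊛ Y ≗ Y ⊕ x ⊛ (Y ⊛ Y ⊖ (Y ⊕ Y) ⊖ x ⊛ (x ⊛ Y))
      regroup = solve 2 (λ x Y → x :* Y :* Y :+ (con 1ℤ :- (x :+ x) :- x :* x :* x) :* Y
                              := Y :+ x :* (Y :* Y :- (Y :+ Y) :- x :* (x :* Y))) R.refl

  S-0 : S 0 ≡ 1ℤ
  S-0 = trans (sym (ℤ.+-identityʳ (S 0))) (S⊕q⊛X≗1 0)

  S-1 : S 1 ≡ 1ℤ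
  S-1 = ℤ.i-j≡0⇒i≡j (S 1) 1ℤ (trans (cong (S 1 +_) (sym (trans (q⊛-suc X 0) X-0))) (S⊕q⊛X≗1 1))
    where
    X-0 : X 0 ≡ - 1ℤ
    X-0 rewrite S-0 = refl

  S-expansion : S ≗ 1s ⊕ q ⊕ q ⊛ (q ⊛ S2 S)
  S-expansion zero          = S-0
  S-expansion (suc zero)    = S-1
  S-expansion (suc (suc n)) =
    sym (trans (ℤ.+-identityˡ _) (trans (q⊛-suc (q ⊛ S2 S) (suc n)) (q⊛-suc (S2 S) n)))

  1⊖S2-equation : (1s ⊖ S2 S) ⊛ (tail₂ (1s ⊖ S2 S) ⊕ q ⊛ q) ≗ tail₂ (1s ⊖ S2 S)
  1⊖S2-equation = q⊛-injective (q⊛-injective (+-cancelʳ 1s (q ⊛ (q ⊛ LHS)) (q ⊛ (q ⊛ B)) (begin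
    q ⊛ (q ⊛ LHS) ⊕ 1s                                 ≈⟨ R.+-congˡ {q ⊛ (q ⊛ LHS)} quadratic≗1 ⟩
    q ⊛ (q ⊛ LHS) ⊕ quadratic (1s ⊕ q ⊕ q ⊛ (q ⊛ s))   ≈⟨ identity q s ⟩
    q ⊛ (q ⊛ B) ⊕ 1s                                    ∎)))
    where
    open Relation.Binary.Reasoning.Setoid R.setoid
    open Algebra.Properties.AbelianGroup R.+-abelianGroup using () renaming (∙-cancelʳ to +-cancelʳ)
    s = S2 S
    T = 1s ⊖ s
    B = tail₂ T
    LHS = T ⊛ (B ⊕ q ⊛ q)
    quadratic≗1 : 1s ≗ quadratic (1s ⊕ q ⊕ q ⊛ (q ⊛ s))
    quadratic≗1 = R.sym (R.trans (quadratic-cong (R.sym S-expansion)) S-eq)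
    -- For Y = 1 + q + q²s and D = q³s² + (1 + 2q² − q³)s − q², one has quadratic Y − 1 = q²D
    -- and T(B + q²) − B = −D; the identity is the sum of the two.
    identity : ∀ x s → let T = 1s ⊖ s; B = (1s ⊕ x ⊛ x) ⊕ neg (x ⊛ x ⊛ x) ⊛ T; Y = 1s ⊕ x ⊕ x ⊛ (x ⊛ s) in
      x ⊛ (x ⊛ (T ⊛ (B ⊕ x ⊛ x))) ⊕ (x ⊛ Y ⊛ Y ⊕ (1s ⊖ (x ⊕ x) ⊖ x ⊛ x ⊛ x) ⊛ Y) ≗ x ⊛ (x ⊛ B) ⊕ 1s
    identity = solve 2 (λ x s →
      let T = con 1ℤ :- s; B = (con 1ℤ :+ x :* x) :+ :- (x :* x :* x) :* T; Y = con 1ℤ :+ x :+ x :* (x :* s) in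
      x :* (x :* (T :* (B :+ x :* x))) :+ (x :* Y :* Y :+ (con 1ℤ :- (x :+ x) :- x :* x :* x) :* Y)
        := x :* (x :* B) :+ con 1ℤ) R.refl

proposition5p1 : (S : Series) → SEquation S →
    QAdicLimit convergent (const 1ℤ ⊖ S2 S)
proposition5p1 S S-eq = convergent-limit (period-fixedPoint (1⊖S2-equation {S} S-eq))
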